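{- Let \(\mathcal U\) and \(\mathcal V\) be universes. If Zorn's-Lemma\(_{\mathcal V,\mathcal V^+\sqcup\mathcal U,\mathcal V}\) holds, then Propositional-Resizing\(_{\mathcal U,\mathcal V}\) holds.
   Context: Setting: intensional Martin-Löf type theory with universes (successor \(\mathcal V^+\), join \(\sqcup\)), function extensionality, propositional extensionality, propositional truncation; excluded middle and resizing are not assumed. A proposition is a type with at most one element. Propositional-Resizing\(_{\mathcal U,\mathcal V}\): every proposition \(P\) in \(\mathcal U\) has size \(\mathcal V\), i.e. is equivalent to some type in \(\mathcal V\). A poset is a type with a proposition-valued reflexive, transitive, antisymmetric relation \(\sqsubseteq\). A \(\mathcal V\)-dcpo is a poset in which every directed family \(\alpha:I\to X\) with \(I:\mathcal V\) (i.e. \(I\) inhabited and for all \(i,j\) there exists \(k\) with \(\alpha_i,\alpha_j\sqsubseteq\alpha_k\)) has a supremum; it is pointed if it has a least element. Zorn's-Lemma\(_{\mathcal V,\mathcal U',\mathcal T}\) asserts that every pointed \(\mathcal V\)-dcpo whose carrier lies in universe \(\mathcal U'\) and whose order takes values in universe \(\mathcal T\) has a maximal element. -}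

module Defs where

open import Level using (Level; _⊔_; suc; Setω)
open import Data.Product using (Σ; _×_; _,_)
open import Relation.Binary.PropositionalEquality using (_≡_)
open import Function.Bundles using (_↔_)
open import Axiom.Extensionality.Propositional using (Extensionality)

isProp : ∀ {ℓ} → Set ℓ → Set ℓ
isProp X = (x y : X) → x ≡ y

FunExt : Setω
FunExt = ∀ {a b} → Extensionality a b

PropExt : Setω
PropExt = ∀ {ℓ} {P Q : Set ℓ} → isProp P → isProp Q → (P → Q) → (Q → P) → P ≡ Q

-- Propositional truncation (as an abstract structure, in the style of TypeTopology).
record PropTrunc : Setω where
  field
    ∥_∥       : ∀ {ℓ} → Set ℓ → Set ℓ
    ∥∥-isProp : ∀ {ℓ} {A : Set ℓ} → isProp ∥ A ∥
    ∣_∣       : ∀ {ℓ} {A : Set ℓ} → A → ∥ A ∥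
    ∥∥-rec    : ∀ {ℓ ℓ'} {A : Set ℓ} {P : Set ℓ'} → isProp P → (A → P) → ∥ A ∥ → P

module _ (pt : PropTrunc) where
  open PropTrunc pt

  Exists : ∀ {a b} (A : Set a) → (A → Set b) → Set (a ⊔ b)
  Exists A B = ∥ Σ A B ∥

  module _ {u t : Level} {X : Set u} (_⊑_ : X → X → Set t) where

    record IsPoset : Set (u ⊔ t) where
      field
        ⊑-prop    : ∀ x y → isProp (x ⊑ y)
        ⊑-refl    : ∀ x → x ⊑ x
        ⊑-trans   : ∀ x y z → x ⊑ y → y ⊑ z → x ⊑ z
        ⊑-antisym : ∀ x y → x ⊑ y → y ⊑ x → x ≡ y

    IsDirected : ∀ {v} {I : Set v} → (I → X) → Set (v ⊔ t)
    IsDirected {I = I} α =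
      ∥ I ∥ × (∀ i j → Exists I (λ k → (α i ⊑ α k) × (α j ⊑ α k)))

    IsUpperBound : ∀ {v} {I : Set v} → (I → X) → X → Set (v ⊔ t)
    IsUpperBound α x = ∀ i → α i ⊑ x

    IsSup : ∀ {v} {I : Set v} → (I → X) → X → Set (u ⊔ v ⊔ t)
    IsSup α x = IsUpperBound α x × (∀ y → IsUpperBound α y → x ⊑ y)

    IsDcpo : (v : Level) → Set (u ⊔ suc v ⊔ t)
    IsDcpo v = ∀ (I : Set v) (α : I → X) → IsDirected α → Σ X (IsSup α)

    IsPointed : Set (u ⊔ t)
    IsPointed = Σ X (λ b → ∀ x → b ⊑ x)

    IsMaximal : X → Set (u ⊔ t)
    IsMaximal x = ∀ y → x ⊑ y → x ≡ y

  ZornsLemma : (v u' t : Level) → Set (suc (v ⊔ u' ⊔ t))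
  ZornsLemma v u' t =
    (X : Set u') (_⊑_ : X → X → Set t) →
    IsPoset _⊑_ → IsDcpo _⊑_ v → IsPointed _⊑_ →
    Exists X (IsMaximal _⊑_)

PropositionalResizing : (u v : Level) → Set (suc u ⊔ suc v)
PropositionalResizing u v = (P : Set u) → isProp P → Σ (Set v) (λ Q → P ↔ Q)

-- Consider the small propositions Q : Set 𝓥 with Q → P, ordered by implication. Joins of
-- arbitrary 𝓥-indexed families exist (the truncated Σ) and ⊥ is least, so Zorn's lemma gives a
-- maximal Q. Given p : P, the proposition ⊤ also lies below P, so maximality forces Q = ⊤ and
-- hence P → Q. Thus Q is a small copy of P; since small copies are unique by propositional
-- extensionality, the copy can be extracted from the truncated existence of the maximal element.
module Submission where

open import Defs
open import Level using (Level; _⊔_; suc; Lift; lift)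
open import Data.Product using (Σ; _×_; _,_; proj₁; proj₂)
open import Data.Empty using (⊥)
open import Data.Unit using (⊤; tt)
open import Relation.Binary.PropositionalEquality
  using (_≡_; refl; sym; trans; subst; cong; cong₂)
open import Relation.Binary.PropositionalEquality.Properties using (trans-symˡ)
open import Function.Bundles using (_↔_; mk↔ₛ′)

private
  variable
    a b : Level
    A : Set a

isProp-× : {B : Set b} → isProp A → isProp B → isProp (A × B)
isProp-× A-prop B-prop (x , y) (x′ , y′) = cong₂ _,_ (A-prop x x′) (B-prop y y′)

isProp-→ : FunExt → {B : Set b} → isProp B → isProp (A → B)
isProp-→ fe B-prop f g = fe λ x → B-prop (f x) (g x)

-- Every path is the canonical one built from the chosen paths of isProp.
isProp⇒isSet : isProp A → {x y : A} (q r : x ≡ y) → q ≡ r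
isProp⇒isSet A-prop {x} {y} q r = trans (canonical q) (sym (canonical r))
  where
  canonical : ∀ {z} (q : x ≡ z) → q ≡ trans (sym (A-prop x x)) (A-prop x z)
  canonical refl = sym (trans-symˡ (A-prop x x))

isProp-isProp : FunExt → isProp (isProp A)
isProp-isProp fe f g = fe λ x → fe λ y → isProp⇒isSet f (f x y) (g x y)

Σ-≡-proj₁ : {B : A → Set b} → (∀ x → isProp (B x)) →
            {u v : Σ A B} → proj₁ u ≡ proj₁ v → u ≡ v
Σ-≡-proj₁ B-prop {x , y} {.x , y′} refl = cong (x ,_) (B-prop x y y′)

module SmallSubprops (pt : PropTrunc) (fe : FunExt) (pe : PropExt)
                     {𝓤 : Level} (𝓥 : Level) {P : Set 𝓤} (P-prop : isProp P) where
  open PropTrunc pt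

  SmallSubprop : Set (suc 𝓥 ⊔ 𝓤)
  SmallSubprop = Σ (Set 𝓥) λ Q → isProp Q × (Q → P)

  _⊑_ : SmallSubprop → SmallSubprop → Set 𝓥
  (Q , _) ⊑ (R , _) = Q → R

  isPoset-⊑ : IsPoset pt _⊑_
  isPoset-⊑ = record
    { ⊑-prop    = λ _ (_ , R-prop , _) → isProp-→ fe R-prop
    ; ⊑-refl    = λ _ q → q
    ; ⊑-trans   = λ _ _ _ f g q → g (f q)
    ; ⊑-antisym = λ (_ , Q-prop , _) (_ , R-prop , _) f g →
        Σ-≡-proj₁ (λ _ → isProp-× (isProp-isProp fe) (isProp-→ fe P-prop))
                  (pe Q-prop R-prop f g)
    }

  isDcpo-⊑ : IsDcpo pt _⊑_ 𝓥
  isDcpo-⊑ I α _ = ⋁α , (λ i q → ∣ i , q ∣) , least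
    where
    ⋁α : SmallSubprop
    ⋁α = ∥ Σ I (λ i → proj₁ (α i)) ∥ , ∥∥-isProp
       , ∥∥-rec P-prop (λ (i , q) → proj₂ (proj₂ (α i)) q)

    least : ∀ R → IsUpperBound pt _⊑_ α R → ⋁α ⊑ R
    least (_ , R-prop , _) ub = ∥∥-rec R-prop (λ (i , q) → ub i q)

  isPointed-⊑ : IsPointed pt _⊑_
  isPointed-⊑ = (Lift 𝓥 ⊥ , (λ ()) , (λ ())) , λ _ ()

  SmallCopy : Set (suc 𝓥 ⊔ 𝓤)
  SmallCopy = Σ (Set 𝓥) λ Q → isProp Q × (P → Q) × (Q → P)

  isProp-SmallCopy : isProp SmallCopy
  isProp-SmallCopy (Q , Q-prop , f , g) (R , R-prop , f′ , g′) =
    Σ-≡-proj₁ isProp-copyData (pe Q-prop R-prop (λ q → f′ (g q)) (λ r → f (g′ r)))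
    where
    isProp-copyData : ∀ S → isProp (isProp S × (P → S) × (S → P))
    isProp-copyData S d@(S-prop , _) =
      isProp-× (isProp-isProp fe) (isProp-× (isProp-→ fe S-prop) (isProp-→ fe P-prop)) d

  maximal⇒SmallCopy : Σ SmallSubprop (IsMaximal pt _⊑_) → SmallCopy
  maximal⇒SmallCopy ((Q , Q-prop , g) , maximal) = Q , Q-prop , f , g
    where
    f : P → Q
    f p = subst proj₁ (sym (maximal ⊤Q (λ _ → lift tt))) (lift tt)
      where
      ⊤Q : SmallSubprop
      ⊤Q = Lift 𝓥 ⊤ , (λ _ _ → refl) , (λ _ → p)

  SmallCopy⇒↔ : SmallCopy → Σ (Set 𝓥) (λ Q → P ↔ Q)
  SmallCopy⇒↔ (Q , Q-prop , f , g) = Q , mk↔ₛ′ f g (λ _ → Q-prop _ _) (λ _ → P-prop _ _)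

theorem4p6 : (pt : PropTrunc) → FunExt → PropExt → (𝓤 𝓥 : Level) →
    ZornsLemma pt 𝓥 (suc 𝓥 ⊔ 𝓤) 𝓥 → PropositionalResizing 𝓤 𝓥
theorem4p6 pt fe pe 𝓤 𝓥 zorn P P-prop =
  SmallCopy⇒↔ (∥∥-rec isProp-SmallCopy maximal⇒SmallCopy
                 (zorn SmallSubprop _⊑_ isPoset-⊑ isDcpo-⊑ isPointed-⊑))
  where
  open PropTrunc pt
  open SmallSubprops pt fe pe 𝓥 P-prop
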